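{- For every integer $d\ge 2$, setting $k:=2d^3+2d^2+d+3$, there exists a finite graph $G$ such that $\chi^d(G\boxtimes K_{d+1})\le k$ but $\chi(G)>k$.
   Context: All graphs are finite and simple. $\chi(G)$ denotes the chromatic number of $G$. For an integer $d\ge 0$, a map $c:V(G)\to S$ to a finite set $S$ is a $d$-defective coloring if for every $s\in S$ the induced subgraph $G[c^{ -1}(s)]$ has maximum degree at most $d$ (i.e., every vertex has at most $d$ neighbors of its own color). $\chi^d(G)$ is the minimum $|S|$ for which a $d$-defective coloring of $G$ with color set $S$ exists. For $t\ge 1$, the strong product $G\boxtimes K_t$ is the graph with vertex set $V(G)\times[t]$, where $[t]=\{1,\dots,t\}$, in which distinct vertices $(u,i)$ and $(v,j)$ are adjacent if and only if either $u=v$ (and $i\neq j$) or $uv\in E(G)$. -}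

module Defs where

open import Data.Nat using (ℕ; _≤_; _*_)
open import Data.Bool using (Bool; true; false; _∧_; _∨_; not; T; T?)
open import Data.Fin using (Fin; quotient; remainder; _≟_)
open import Data.List using (List; length; filter)
open import Data.Product using (Σ; ∃; _×_; _,_)
open import Relation.Binary.PropositionalEquality using (_≡_)
open import Relation.Nullary using (¬_)
open import Relation.Nullary.Decidable using (⌊_⌋)
open import Data.List using (allFin) public

record Graph : Set where
  field
    n   : ℕ
    adj : Fin n → Fin n → Bool
open Graph public

record IsSimple (G : Graph) : Set where
  field
    sym     : ∀ u v → adj G u v ≡ adj G v u
    irrefl  : ∀ v → adj G v v ≡ false

-- Vertex (u , i) ∈ V(G) × [t] is encoded as the
-- element of Fin (n * t) with quotient u and remainder i (Data.Fin.combine).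
_⊠K_ : Graph → ℕ → Graph
G ⊠K t = record
  { n   = n G * t
  ; adj = λ x y → not ⌊ x ≟ y ⌋ ∧
           (⌊ quotient {n G} t x ≟ quotient {n G} t y ⌋ ∨ adj G (quotient {n G} t x) (quotient {n G} t y)) }

sameColourDeg : (G : Graph) {k : ℕ} → (Fin (n G) → Fin k) → Fin (n G) → ℕ
sameColourDeg G c v =
  length (filter (λ u → T? (adj G u v ∧ ⌊ c u ≟ c v ⌋)) (allFin (n G)))

IsDefectiveColouring : (d : ℕ) (G : Graph) {k : ℕ} → (Fin (n G) → Fin k) → Set
IsDefectiveColouring d G c = ∀ v → sameColourDeg G c v ≤ d

DefChromLe : (d : ℕ) (G : Graph) (k : ℕ) → Set
DefChromLe d G k = Σ (Fin (n G) → Fin k) (IsDefectiveColouring d G)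

IsProperColouring : (G : Graph) {k : ℕ} → (Fin (n G) → Fin k) → Set
IsProperColouring G c = ∀ u v → T (adj G u v) → ¬ (c u ≡ c v)

ChromGt : (G : Graph) (k : ℕ) → Set
ChromGt G k = ¬ Σ (Fin (n G) → Fin k) (IsProperColouring G)

-- G is the join of a clique K_{s+1} with (d+1)² disjoint five-cycles, indexed by pairs (h , r).
-- A proper colouring needs s + 1 colours on the clique and three more on each five-cycle,
-- so χ(G) = s + 1 + 3(d+1)².
-- In G ⊠ K_{d+1} each blown-up five-cycle gets three colours A, B, C: A covers all d + 1 copies of
-- position 0 together with up to d + 1 copies at positions 2 and 3, which are not adjacent to
-- position 0, and B does the same around position 4. The copies of the extra clique vertex take colour C (0 , 0),
-- and the displaced vertices are shifted along the C colours of the other cycles; the classes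
-- C (h , r + 1) grow to d + 2 vertices, but each of them misses one of the others, so every vertex
-- still has at most d neighbours of its own colour.
module Submission where

open import Defs
open import Data.Nat using (ℕ; _≤_; _+_; _*_; _^_)
open import Data.Product using (Σ; _×_)

open import Data.Bool using (Bool; true; false; T; T?; not; _∧_; _∨_)
open import Data.Bool.Properties using (T-∧; T-∨; T-≡; ∨-comm)
open import Data.Empty using (⊥-elim)
open import Data.Fin as Fin using (Fin; zero; suc; punchOut; quotient)
open import Data.Fin.Patterns using (0F; 1F; 2F; 3F; 4F)
open import Data.Fin.Properties using (punchOut-injective; suc-injective; 0≢1+n; ¬Fin0; +↔⊎; *↔×; injective⇒≤)
open import Data.List using (length; filter; tabulate)
open import Data.Nat using (zero; suc; z≤n; s≤s; _<_)
open import Data.Nat.Properties using (+-comm; <⇒≱; n<1+n)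
open import Data.Nat.Solver using (module +-*-Solver)
open import Data.Product using (_,_; proj₁; proj₂)
open import Data.Product.Function.NonDependent.Propositional using (_×-↔_)
open import Data.Product.Properties using (≡-dec)
open import Data.Sum using (_⊎_; inj₁; inj₂)
import Data.Sum as Sum
open import Data.Sum.Function.Propositional using (_⊎-↔_)
open import Function using (_∘_; id; _↔_; Inverse; Injection; Equivalence)
open import Function.Definitions using (Injective)
open import Function.Properties.Inverse using (↔-refl; ↔-sym; ↔-trans; ↔⇒↣)
open import Relation.Binary.Definitions using (DecidableEquality)
open import Relation.Binary.PropositionalEquality
open import Relation.Nullary using (¬_; yes; no)
open import Relation.Nullary.Decidable using (⌊_⌋; toWitness; fromWitness; toWitnessFalse; fromWitnessFalse)

⌊≟⌋-refl : ∀ {A : Set} (_≟_ : DecidableEquality A) x → ⌊ x ≟ x ⌋ ≡ true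
⌊≟⌋-refl _≟_ x = Equivalence.to T-≡ (fromWitness {a? = x ≟ x} refl)

⌊≟⌋-sym : ∀ {A : Set} (_≟_ : DecidableEquality A) x y → ⌊ x ≟ y ⌋ ≡ ⌊ y ≟ x ⌋
⌊≟⌋-sym _≟_ x y with x ≟ y | y ≟ x
... | yes _   | yes _   = refl
... | no _    | no _    = refl
... | yes x≡y | no y≢x  = ⊥-elim (y≢x (sym x≡y))
... | no x≢y  | yes y≡x = ⊥-elim (x≢y (sym y≡x))

from-injective : ∀ {A B : Set} (f : A ↔ B) → Injective _≡_ _≡_ (Inverse.from f)
from-injective f = Injection.injective (↔⇒↣ (↔-sym f))

to-injective : ∀ {A B : Set} (f : A ↔ B) → Injective _≡_ _≡_ (Inverse.to f)
to-injective f = Injection.injective (↔⇒↣ f)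

length-filter-tabulate≤ : ∀ {A : Set} {n m} (f : Fin n → A) (P : A → Bool)
  (h : ∀ i → T (P (f i)) → Fin m) → (∀ i j p q → h i p ≡ h j q → i ≡ j) →
  length (filter (T? ∘ P) (tabulate f)) ≤ m
length-filter-tabulate≤ {n = zero} f P h h-inj = z≤n
length-filter-tabulate≤ {n = suc n} {m} f P h h-inj with P (f zero) in eq
... | false = length-filter-tabulate≤ (f ∘ suc) P (h ∘ suc) (λ i j p q → suc-injective ∘ h-inj _ _ p q)
... | true  = bound m h h-inj
  where
  p₀ : T (P (f zero))
  p₀ = Equivalence.from T-≡ eq

  bound : ∀ m (h : ∀ i → T (P (f i)) → Fin m) → (∀ i j p q → h i p ≡ h j q → i ≡ j) →
    suc (length (filter (T? ∘ P) (tabulate (f ∘ suc)))) ≤ m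
  bound zero    h h-inj = ⊥-elim (¬Fin0 (h zero p₀))
  bound (suc m) h h-inj = s≤s (length-filter-tabulate≤ (f ∘ suc) P h′ h′-inj)
    where
    h₀≢ : ∀ i p → h zero p₀ ≢ h (suc i) p
    h₀≢ i p = 0≢1+n ∘ h-inj _ _ p₀ p

    h′ : ∀ i → T (P (f (suc i))) → Fin m
    h′ i p = punchOut (h₀≢ i p)

    h′-inj : ∀ i j p q → h′ i p ≡ h′ j q → i ≡ j
    h′-inj i j p q = suc-injective ∘ h-inj _ _ p q ∘ punchOut-injective (h₀≢ i p) (h₀≢ j q)

module _ (G : Graph) {k : ℕ} (c : Fin (n G) → Fin k) where

  SameColourNeighbour : Fin (n G) → Fin (n G) → Set
  SameColourNeighbour x y = T (adj G y x) × c y ≡ c x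

  sameColourDeg≤ : ∀ {m} x (label : Fin (n G) → Fin (suc (suc m))) {ℓ₁ ℓ₂} → ℓ₁ ≢ ℓ₂ →
    (∀ y → SameColourNeighbour x y → label y ≢ ℓ₁) →
    (∀ y → SameColourNeighbour x y → label y ≢ ℓ₂) →
    (∀ y y′ → SameColourNeighbour x y → SameColourNeighbour x y′ → label y ≡ label y′ → y ≡ y′) →
    sameColourDeg G c x ≤ m
  sameColourDeg≤ {m} x label {ℓ₁} {ℓ₂} ℓ₁≢ℓ₂ avoid₁ avoid₂ label-inj =
    length-filter-tabulate≤ id (λ y → adj G y x ∧ ⌊ c y Fin.≟ c x ⌋) h h-inj
    where
    neighbour : ∀ y → T (adj G y x ∧ ⌊ c y Fin.≟ c x ⌋) → SameColourNeighbour x y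
    neighbour y t = let (y~x , same) = Equivalence.to T-∧ t in y~x , toWitness same

    ℓ₁≢ : ∀ y p → ℓ₁ ≢ label y
    ℓ₁≢ y p = avoid₁ y (neighbour y p) ∘ sym

    ℓ₂′≢ : ∀ y p → punchOut ℓ₁≢ℓ₂ ≢ punchOut (ℓ₁≢ y p)
    ℓ₂′≢ y p = avoid₂ y (neighbour y p) ∘ sym ∘ punchOut-injective ℓ₁≢ℓ₂ (ℓ₁≢ y p)

    h : ∀ y → T (adj G y x ∧ ⌊ c y Fin.≟ c x ⌋) → Fin m
    h y p = punchOut (ℓ₂′≢ y p)

    h-inj : ∀ y y′ p q → h y p ≡ h y′ q → y ≡ y′
    h-inj y y′ p q = label-inj y y′ (neighbour y p) (neighbour y′ q)
                   ∘ punchOut-injective (ℓ₁≢ y p) (ℓ₁≢ y′ q)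
                   ∘ punchOut-injective (ℓ₂′≢ y p) (ℓ₂′≢ y′ q)

⊠K-adjacent : ∀ G t {x y} → T (adj (G ⊠K t) y x) →
  y ≢ x × (quotient {n G} t y ≡ quotient t x ⊎ T (adj G (quotient t y) (quotient t x)))
⊠K-adjacent G t {x} {y} y~x =
  toWitnessFalse (proj₁ split) , Sum.map₁ toWitness (Equivalence.to (T-∨ {⌊ qy Fin.≟ qx ⌋}) (proj₂ split))
  where
  qx qy : Fin (n G)
  qx = quotient t x
  qy = quotient t y

  split : T (not ⌊ y Fin.≟ x ⌋) × T (⌊ qy Fin.≟ qx ⌋ ∨ adj G qy qx)
  split = Equivalence.to T-∧ y~x

Pos : Set
Pos = Fin 5

next : Pos → Pos
next 0F = 1F
next 1F = 2F
next 2F = 3F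
next 3F = 4F
next 4F = 0F

C₅-adj : Pos → Pos → Bool
C₅-adj a b = ⌊ b Fin.≟ next a ⌋ ∨ ⌊ a Fin.≟ next b ⌋

C₅-adj-sym : ∀ a b → C₅-adj a b ≡ C₅-adj b a
C₅-adj-sym a b = ∨-comm ⌊ b Fin.≟ next a ⌋ ⌊ a Fin.≟ next b ⌋

C₅-adj-irrefl : ∀ a → C₅-adj a a ≡ false
C₅-adj-irrefl 0F = refl
C₅-adj-irrefl 1F = refl
C₅-adj-irrefl 2F = refl
C₅-adj-irrefl 3F = refl
C₅-adj-irrefl 4F = refl

module _ {C : Set} (_≟_ : DecidableEquality C) (f : Pos → C)
         (proper : ∀ a b → T (C₅-adj a b) → f a ≢ f b) where

  C₅-rainbow-triangle : Σ (Fin 3 → Pos) λ π → Injective _≡_ _≡_ (f ∘ π)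
  C₅-rainbow-triangle = π , π-injective
    where
    third : Σ Pos λ a → f a ≢ f 0F × f a ≢ f 1F
    third with f 2F ≟ f 0F
    ... | no 2≢0 = 2F , 2≢0 , proper 2F 1F _
    ... | yes 2≡0 with f 3F ≟ f 1F
    ...   | no 3≢1  = 3F , (λ 3≡0 → proper 3F 2F _ (trans 3≡0 (sym 2≡0))) , 3≢1
    ...   | yes 3≡1 = 4F , proper 4F 0F _ , (λ 4≡1 → proper 4F 3F _ (trans 4≡1 (sym 3≡1)))

    π : Fin 3 → Pos
    π 0F = 0F
    π 1F = 1F
    π 2F = proj₁ third

    distinct : ∀ i j → i ≢ j → f (π i) ≢ f (π j)
    distinct 0F 0F i≢j = ⊥-elim (i≢j refl)
    distinct 0F 1F _   = proper 0F 1F _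
    distinct 0F 2F _   = proj₁ (proj₂ third) ∘ sym
    distinct 1F 0F _   = proper 1F 0F _
    distinct 1F 1F i≢j = ⊥-elim (i≢j refl)
    distinct 1F 2F _   = proj₂ (proj₂ third) ∘ sym
    distinct 2F 0F _   = proj₁ (proj₂ third)
    distinct 2F 1F _   = proj₂ (proj₂ third)
    distinct 2F 2F i≢j = ⊥-elim (i≢j refl)

    π-injective : Injective _≡_ _≡_ (f ∘ π)
    π-injective {i} {j} same with i Fin.≟ j
    ... | yes i≡j = i≡j
    ... | no i≢j  = ⊥-elim (distinct i j i≢j same)

+*↔⊎× : ∀ m D r → Fin (m + D * D * r) ↔ (Fin m ⊎ ((Fin D × Fin D) × Fin r))
+*↔⊎× m D r = ↔-trans +↔⊎ (↔-refl ⊎-↔ (↔-trans *↔× (*↔× ×-↔ ↔-refl)))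

module CliqueJoinC₅ (m D : ℕ) where

  Part : Set
  Part = Fin D × Fin D

  _≟ₚ_ : DecidableEquality Part
  _≟ₚ_ = ≡-dec Fin._≟_ Fin._≟_

  Vertex : Set
  Vertex = Fin m ⊎ (Part × Pos)

  adjacent : Vertex → Vertex → Bool
  adjacent (inj₁ u)       (inj₁ v)       = not ⌊ u Fin.≟ v ⌋
  adjacent (inj₁ _)       (inj₂ _)       = true
  adjacent (inj₂ _)       (inj₁ _)       = true
  adjacent (inj₂ (p , a)) (inj₂ (q , b)) = not ⌊ p ≟ₚ q ⌋ ∨ C₅-adj a b

  adjacent-sym : ∀ u v → adjacent u v ≡ adjacent v u
  adjacent-sym (inj₁ u)       (inj₁ v)       = cong not (⌊≟⌋-sym Fin._≟_ u v)
  adjacent-sym (inj₁ _)       (inj₂ _)       = refl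
  adjacent-sym (inj₂ _)       (inj₁ _)       = refl
  adjacent-sym (inj₂ (p , a)) (inj₂ (q , b)) = cong₂ (λ x y → not x ∨ y) (⌊≟⌋-sym _≟ₚ_ p q) (C₅-adj-sym a b)

  adjacent-irrefl : ∀ v → adjacent v v ≡ false
  adjacent-irrefl (inj₁ u)       = cong not (⌊≟⌋-refl Fin._≟_ u)
  adjacent-irrefl (inj₂ (p , a)) = cong₂ (λ x y → not x ∨ y) (⌊≟⌋-refl _≟ₚ_ p) (C₅-adj-irrefl a)

  C₅-adjacent : ∀ p {a b} → T (C₅-adj a b) → T (adjacent (inj₂ (p , a)) (inj₂ (p , b)))
  C₅-adjacent p = Equivalence.from (T-∨ {not ⌊ p ≟ₚ p ⌋}) ∘ inj₂

  parts-adjacent : ∀ {p q} a b → p ≢ q → T (adjacent (inj₂ (p , a)) (inj₂ (q , b)))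
  parts-adjacent {p} {q} a b = Equivalence.from (T-∨ {not ⌊ p ≟ₚ q ⌋} {C₅-adj a b}) ∘ inj₁ ∘ fromWitnessFalse

  vertices : Fin (m + D * D * 5) ↔ Vertex
  vertices = +*↔⊎× m D 5

  graph : Graph
  graph = record
    { n   = m + D * D * 5
    ; adj = λ u v → adjacent (Inverse.to vertices u) (Inverse.to vertices v)
    }

  graph-simple : IsSimple graph
  graph-simple = record
    { sym    = λ u v → adjacent-sym (Inverse.to vertices u) (Inverse.to vertices v)
    ; irrefl = λ v → adjacent-irrefl (Inverse.to vertices v)
    }

  graph-ChromGt : ∀ {k} → k < m + D * D * 3 → ChromGt graph k
  graph-ChromGt {k} k<χ (f , f-proper) =
    <⇒≱ k<χ (injective⇒≤ (to-injective (+*↔⊎× m D 3) ∘ witness-injective))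
    where
    colour : Vertex → Fin k
    colour = f ∘ Inverse.from vertices

    proper : ∀ u v → T (adjacent u v) → colour u ≢ colour v
    proper u v = f-proper _ _ ∘ subst₂ (λ u′ v′ → T (adjacent u′ v′))
                   (sym (Inverse.strictlyInverseˡ vertices u)) (sym (Inverse.strictlyInverseˡ vertices v))

    rainbow : ∀ p → Σ (Fin 3 → Pos) λ π → Injective _≡_ _≡_ (λ i → colour (inj₂ (p , π i)))
    rainbow p = C₅-rainbow-triangle Fin._≟_ (λ a → colour (inj₂ (p , a)))
                  (λ a b → proper (inj₂ (p , a)) (inj₂ (p , b)) ∘ C₅-adjacent p {a} {b})

    witness : Fin m ⊎ (Part × Fin 3) → Vertex
    witness (inj₁ u)       = inj₁ u
    witness (inj₂ (p , i)) = inj₂ (p , proj₁ (rainbow p) i)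

    witness-injective : Injective _≡_ _≡_ (colour ∘ witness)
    witness-injective {inj₁ u} {inj₁ v} same with u Fin.≟ v
    ... | yes u≡v = cong inj₁ u≡v
    ... | no u≢v  = ⊥-elim (proper (inj₁ u) (inj₁ v) (fromWitnessFalse u≢v) same)
    witness-injective {inj₁ u} {inj₂ y} same = ⊥-elim (proper (inj₁ u) (witness (inj₂ y)) _ same)
    witness-injective {inj₂ y} {inj₁ u} same = ⊥-elim (proper (witness (inj₂ y)) (inj₁ u) _ same)
    witness-injective {inj₂ (p , i)} {inj₂ (q , j)} same with p ≟ₚ q
    ... | yes refl = cong (λ j → inj₂ (p , j)) (proj₂ (rainbow p) same)
    ... | no p≢q   = ⊥-elim (proper (witness (inj₂ (p , i))) (witness (inj₂ (q , j)))
                               (parts-adjacent (proj₁ (rainbow p) i) (proj₁ (rainbow q) j) p≢q) same)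

module DefectiveColouring (s e : ℕ) where

  d D : ℕ
  d = 2 + e
  D = suc d

  open CliqueJoinC₅ (suc s) D

  Colour : Set
  Colour = Fin s ⊎ (Part × Fin 3)

  pattern clique w = inj₁ w
  pattern A p = inj₂ (p , 0F)
  pattern B p = inj₂ (p , 1F)
  pattern C p = inj₂ (p , 2F)

  -- A colour class is a single group, except A p and B p: each joins the group of all copies of
  -- position 0 (resp. 4) of part p with a group lying at positions not adjacent to it.
  data Group : Set where
    all₀ all₄ : Part → Group
    rest      : Colour → Group

  colourOf : Group → Colour
  colourOf (all₀ p) = A p
  colourOf (all₄ p) = B p
  colourOf (rest c) = c

  data Merged : Group → Group → Set where
    A-halves : ∀ p → Merged (all₀ p) (rest (A p))
    B-halves : ∀ p → Merged (all₄ p) (rest (B p))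

  colourOf-inv : ∀ {g g′} → colourOf g ≡ colourOf g′ → g ≡ g′ ⊎ Merged g g′ ⊎ Merged g′ g
  colourOf-inv {all₀ p} {all₀ .p}       refl = inj₁ refl
  colourOf-inv {all₀ p} {rest .(A p)}   refl = inj₂ (inj₁ (A-halves p))
  colourOf-inv {all₄ p} {all₄ .p}       refl = inj₁ refl
  colourOf-inv {all₄ p} {rest .(B p)}   refl = inj₂ (inj₁ (B-halves p))
  colourOf-inv {rest .(A p)} {all₀ p}   refl = inj₂ (inj₂ (A-halves p))
  colourOf-inv {rest .(B p)} {all₄ p}   refl = inj₂ (inj₂ (B-halves p))
  colourOf-inv {rest c} {rest .c}       refl = inj₁ refl

  -- A vertex's label identifies it within its group (member inverts place), and its spare is a
  -- label that none of its same-colour neighbours carries: label 0 is unused except in the groups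
  -- C (h , suc r) of d + 2 vertices, where the spare names a non-adjacent group mate.
  record Slot : Set where
    constructor slot
    field
      group       : Group
      label spare : Fin (suc D)
      label≢spare : label ≢ spare

  place : Vertex × Fin D → Slot
  place (inj₁ 0F , i)                           = slot (rest (C (0F , 0F)))      (suc i) 0F λ ()
  place (inj₁ (suc w) , i)                      = slot (rest (clique w))         (suc i) 0F λ ()
  place (inj₂ (p , 0F) , i)                     = slot (all₀ p)                  (suc i) 0F λ ()
  place (inj₂ (p , 4F) , i)                     = slot (all₄ p)                  (suc i) 0F λ ()
  place (inj₂ ((h , 0F) , 1F) , 0F)             = slot (rest (B (h , 0F)))       1F 0F λ ()
  place (inj₂ ((h , 0F) , 1F) , suc r)          = slot (rest (C (h , suc r)))    2F 0F λ ()
  place (inj₂ ((h , 0F) , 2F) , 0F)             = slot (rest (A (h , 0F)))       1F 0F λ ()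
  place (inj₂ ((h , 0F) , 2F) , suc r)          = slot (rest (B (h , 0F)))       (suc (suc r)) 0F λ ()
  place (inj₂ ((h , 0F) , 3F) , 0F)             = slot (rest (A (h , 0F)))       2F 0F λ ()
  place (inj₂ ((h , 0F) , 3F) , suc r)          = slot (rest (C (h , suc r)))    0F 2F λ ()
  place (inj₂ ((h , suc r) , 1F) , 0F)          = slot (rest (C (suc r , 0F)))   (suc h) 0F λ ()
  place (inj₂ ((h , suc r) , 1F) , 1F)          = slot (rest (C (h , suc r)))    1F 3F λ ()
  place (inj₂ ((h , suc r) , 1F) , suc (suc t)) = slot (rest (B (h , suc r)))    (suc (suc (suc t))) 0F λ ()
  place (inj₂ ((h , suc r) , 2F) , 0F)          = slot (rest (B (h , suc r)))    1F 0F λ ()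
  place (inj₂ ((h , suc r) , 2F) , 1F)          = slot (rest (B (h , suc r)))    2F 0F λ ()
  place (inj₂ ((h , suc r) , 2F) , suc (suc t)) = slot (rest (A (h , suc r)))    (suc (suc (suc t))) 0F λ ()
  place (inj₂ ((h , suc r) , 3F) , 0F)          = slot (rest (A (h , suc r)))    1F 0F λ ()
  place (inj₂ ((h , suc r) , 3F) , 1F)          = slot (rest (A (h , suc r)))    2F 0F λ ()
  place (inj₂ ((h , suc r) , 3F) , suc (suc t)) = slot (rest (C (h , suc r)))    (suc (suc (suc t))) 1F λ ()

  group : Vertex × Fin D → Group
  group = Slot.group ∘ place

  label spare : Vertex × Fin D → Fin (suc D)
  label = Slot.label ∘ place
  spare = Slot.spare ∘ place

  copy : Fin (suc D) → Fin D
  copy 0F      = 0F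
  copy (suc i) = i

  -- Unused labels are sent to a vertex of the right part and position, which keeps merged-far exceptionless.
  member : Group → Fin (suc D) → Vertex × Fin D
  member (all₀ p) ℓ                                = inj₂ (p , 0F) , copy ℓ
  member (all₄ p) ℓ                                = inj₂ (p , 4F) , copy ℓ
  member (rest (clique w)) ℓ                       = inj₁ (suc w) , copy ℓ
  member (rest (A (h , 0F))) 2F                    = inj₂ ((h , 0F) , 3F) , 0F
  member (rest (A (h , 0F))) _                     = inj₂ ((h , 0F) , 2F) , 0F
  member (rest (A (h , suc r))) 2F                 = inj₂ ((h , suc r) , 3F) , 1F
  member (rest (A (h , suc r))) (suc (suc (suc t))) = inj₂ ((h , suc r) , 2F) , suc (suc t)
  member (rest (A (h , suc r))) _                  = inj₂ ((h , suc r) , 3F) , 0F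
  member (rest (B (h , 0F))) (suc (suc r))         = inj₂ ((h , 0F) , 2F) , suc r
  member (rest (B (h , 0F))) _                     = inj₂ ((h , 0F) , 1F) , 0F
  member (rest (B (h , suc r))) 2F                 = inj₂ ((h , suc r) , 2F) , 1F
  member (rest (B (h , suc r))) (suc (suc (suc t))) = inj₂ ((h , suc r) , 1F) , suc (suc t)
  member (rest (B (h , suc r))) _                  = inj₂ ((h , suc r) , 2F) , 0F
  member (rest (C (h , suc r))) 0F                 = inj₂ ((h , 0F) , 3F) , suc r
  member (rest (C (h , suc r))) 1F                 = inj₂ ((h , suc r) , 1F) , 1F
  member (rest (C (h , suc r))) 2F                 = inj₂ ((h , 0F) , 1F) , suc r
  member (rest (C (h , suc r))) (suc (suc (suc t))) = inj₂ ((h , suc r) , 3F) , suc (suc t)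
  member (rest (C (0F , 0F))) ℓ                    = inj₁ 0F , copy ℓ
  member (rest (C (suc r , 0F))) ℓ                 = inj₂ ((copy ℓ , suc r) , 1F) , 0F

  member-place : ∀ q → member (group q) (label q) ≡ q
  member-place (inj₁ 0F , i)                           = refl
  member-place (inj₁ (suc w) , i)                      = refl
  member-place (inj₂ (p , 0F) , i)                     = refl
  member-place (inj₂ (p , 4F) , i)                     = refl
  member-place (inj₂ ((h , 0F) , 1F) , 0F)             = refl
  member-place (inj₂ ((h , 0F) , 1F) , suc r)          = refl
  member-place (inj₂ ((h , 0F) , 2F) , 0F)             = refl
  member-place (inj₂ ((h , 0F) , 2F) , suc r)          = refl
  member-place (inj₂ ((h , 0F) , 3F) , 0F)             = refl
  member-place (inj₂ ((h , 0F) , 3F) , suc r)          = refl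
  member-place (inj₂ ((h , suc r) , 1F) , 0F)          = refl
  member-place (inj₂ ((h , suc r) , 1F) , 1F)          = refl
  member-place (inj₂ ((h , suc r) , 1F) , suc (suc t)) = refl
  member-place (inj₂ ((h , suc r) , 2F) , 0F)          = refl
  member-place (inj₂ ((h , suc r) , 2F) , 1F)          = refl
  member-place (inj₂ ((h , suc r) , 2F) , suc (suc t)) = refl
  member-place (inj₂ ((h , suc r) , 3F) , 0F)          = refl
  member-place (inj₂ ((h , suc r) , 3F) , 1F)          = refl
  member-place (inj₂ ((h , suc r) , 3F) , suc (suc t)) = refl

  Close : Vertex → Vertex → Set
  Close u v = u ≡ v ⊎ T (adjacent u v)

  Close-sym : ∀ {u v} → Close u v → Close v u
  Close-sym {u} {v} = Sum.map sym (subst T (adjacent-sym u v))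

  C₅-far : ∀ {p a b} → a ≢ b → C₅-adj a b ≡ false → ¬ Close (inj₂ (p , a)) (inj₂ (p , b))
  C₅-far a≢b _         (inj₁ refl) = a≢b refl
  C₅-far {p} _ a≁b (inj₂ a~b) =
    subst T (cong₂ (λ x y → not x ∨ y) (⌊≟⌋-refl _≟ₚ_ p) a≁b) a~b

  merged-far : ∀ {g g′} → Merged g g′ → ∀ ℓ ℓ′ → ¬ Close (proj₁ (member g ℓ)) (proj₁ (member g′ ℓ′))
  merged-far (A-halves (h , 0F))    ℓ 0F                  = C₅-far (λ ()) refl
  merged-far (A-halves (h , 0F))    ℓ 1F                  = C₅-far (λ ()) refl
  merged-far (A-halves (h , 0F))    ℓ 2F                  = C₅-far (λ ()) refl
  merged-far (A-halves (h , 0F))    ℓ (suc (suc (suc t))) = C₅-far (λ ()) refl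
  merged-far (A-halves (h , suc r)) ℓ 0F                  = C₅-far (λ ()) refl
  merged-far (A-halves (h , suc r)) ℓ 1F                  = C₅-far (λ ()) refl
  merged-far (A-halves (h , suc r)) ℓ 2F                  = C₅-far (λ ()) refl
  merged-far (A-halves (h , suc r)) ℓ (suc (suc (suc t))) = C₅-far (λ ()) refl
  merged-far (B-halves (h , 0F))    ℓ 0F                  = C₅-far (λ ()) refl
  merged-far (B-halves (h , 0F))    ℓ 1F                  = C₅-far (λ ()) refl
  merged-far (B-halves (h , 0F))    ℓ (suc (suc r))       = C₅-far (λ ()) refl
  merged-far (B-halves (h , suc r)) ℓ 0F                  = C₅-far (λ ()) refl
  merged-far (B-halves (h , suc r)) ℓ 1F                  = C₅-far (λ ()) refl
  merged-far (B-halves (h , suc r)) ℓ 2F                  = C₅-far (λ ()) refl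
  merged-far (B-halves (h , suc r)) ℓ (suc (suc (suc t))) = C₅-far (λ ()) refl

  close-members : ∀ q q′ → Close (proj₁ q) (proj₁ q′) →
    Close (proj₁ (member (group q) (label q))) (proj₁ (member (group q′) (label q′)))
  close-members q q′ =
    subst₂ (λ u v → Close (proj₁ u) (proj₁ v)) (sym (member-place q)) (sym (member-place q′))

  same-group : ∀ q q′ → colourOf (group q) ≡ colourOf (group q′) → Close (proj₁ q) (proj₁ q′) →
    group q ≡ group q′
  same-group q q′ same close with colourOf-inv same
  ... | inj₁ q≡q′        = q≡q′
  ... | inj₂ (inj₁ q⋈q′) = ⊥-elim (merged-far q⋈q′ (label q) (label q′) (close-members q q′ close))
  ... | inj₂ (inj₂ q′⋈q) = ⊥-elim (merged-far q′⋈q (label q′) (label q) (close-members q′ q (Close-sym close)))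

  spare-far : ∀ q → label (member (group q) (spare q)) ≡ spare q →
    ¬ Close (proj₁ (member (group q) (spare q))) (proj₁ q)
  spare-far (inj₁ 0F , i)                           ()
  spare-far (inj₁ (suc w) , i)                      ()
  spare-far (inj₂ (p , 0F) , i)                     ()
  spare-far (inj₂ (p , 4F) , i)                     ()
  spare-far (inj₂ ((h , 0F) , 1F) , 0F)             ()
  spare-far (inj₂ ((h , 0F) , 1F) , suc r)          _ = C₅-far (λ ()) refl
  spare-far (inj₂ ((h , 0F) , 2F) , 0F)             ()
  spare-far (inj₂ ((h , 0F) , 2F) , suc r)          ()
  spare-far (inj₂ ((h , 0F) , 3F) , 0F)             ()
  spare-far (inj₂ ((h , 0F) , 3F) , suc r)          _ = C₅-far (λ ()) refl
  spare-far (inj₂ ((h , suc r) , 1F) , 0F)          ()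
  spare-far (inj₂ ((h , suc r) , 1F) , 1F)          _ = C₅-far (λ ()) refl
  spare-far (inj₂ ((h , suc r) , 1F) , suc (suc t)) ()
  spare-far (inj₂ ((h , suc r) , 2F) , 0F)          ()
  spare-far (inj₂ ((h , suc r) , 2F) , 1F)          ()
  spare-far (inj₂ ((h , suc r) , 2F) , suc (suc t)) ()
  spare-far (inj₂ ((h , suc r) , 3F) , 0F)          ()
  spare-far (inj₂ ((h , suc r) , 3F) , 1F)          ()
  spare-far (inj₂ ((h , suc r) , 3F) , suc (suc t)) _ = C₅-far (λ ()) refl

  cells : Fin (n graph * D) ↔ (Vertex × Fin D)
  cells = ↔-trans *↔× (vertices ×-↔ ↔-refl)

  cell : Fin (n graph * D) → Vertex × Fin D
  cell = Inverse.to cells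

  colouring : Fin (n graph * D) → Fin (s + D * D * 3)
  colouring = Inverse.from (+*↔⊎× s D 3) ∘ colourOf ∘ group ∘ cell

  module _ (x y : Fin (n graph * D)) (y~x : SameColourNeighbour (graph ⊠K D) colouring x y) where

    neighbour≢ : y ≢ x
    neighbour≢ = proj₁ (⊠K-adjacent graph D {x} {y} (proj₁ y~x))

    neighbour-close : Close (proj₁ (cell y)) (proj₁ (cell x))
    neighbour-close = Sum.map₁ (cong (Inverse.to vertices)) (proj₂ (⊠K-adjacent graph D {x} {y} (proj₁ y~x)))

    neighbour-member : cell y ≡ member (group (cell x)) (label (cell y))
    neighbour-member = trans (sym (member-place (cell y)))
      (cong (λ g → member g (label (cell y)))
        (same-group (cell y) (cell x) (from-injective (+*↔⊎× s D 3) (proj₂ y~x)) neighbour-close))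

  colouring-defective : IsDefectiveColouring d (graph ⊠K D) colouring
  colouring-defective x =
    sameColourDeg≤ (graph ⊠K D) colouring x (label ∘ cell) (Slot.label≢spare (place (cell x)))
      label≢ spare≢ label-injective
    where
    cell-injective : ∀ {y y′} → cell y ≡ cell y′ → y ≡ y′
    cell-injective = to-injective cells

    label≢ : ∀ y → SameColourNeighbour (graph ⊠K D) colouring x y → label (cell y) ≢ label (cell x)
    label≢ y y~x same = neighbour≢ x y y~x (cell-injective (begin
      cell y                                      ≡⟨ neighbour-member x y y~x ⟩
      member (group (cell x)) (label (cell y))    ≡⟨ cong (member (group (cell x))) same ⟩
      member (group (cell x)) (label (cell x))    ≡⟨ member-place (cell x) ⟩
      cell x                                      ∎))
      where open ≡-Reasoning

    spare≢ : ∀ y → SameColourNeighbour (graph ⊠K D) colouring x y → label (cell y) ≢ spare (cell x)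
    spare≢ y y~x same = spare-far (cell x)
      (subst (λ q → label q ≡ spare (cell x)) y≡spare same)
      (subst (λ q → Close (proj₁ q) (proj₁ (cell x))) y≡spare (neighbour-close x y y~x))
      where
      y≡spare : cell y ≡ member (group (cell x)) (spare (cell x))
      y≡spare = trans (neighbour-member x y y~x) (cong (member (group (cell x))) same)

    label-injective : ∀ y y′ → SameColourNeighbour (graph ⊠K D) colouring x y →
      SameColourNeighbour (graph ⊠K D) colouring x y′ → label (cell y) ≡ label (cell y′) → y ≡ y′
    label-injective y y′ y~x y′~x same = cell-injective (begin
      cell y                                      ≡⟨ neighbour-member x y y~x ⟩
      member (group (cell x)) (label (cell y))    ≡⟨ cong (member (group (cell x))) same ⟩
      member (group (cell x)) (label (cell y′))   ≡⟨ neighbour-member x y′ y′~x ⟨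
      cell y′                                     ∎)
      where open ≡-Reasoning

  product-DefChromLe : DefChromLe d (graph ⊠K D) (s + D * D * 3)
  product-DefChromLe = colouring , colouring-defective

theorem1 : (d : ℕ) → 2 ≤ d →
    Σ Graph (λ G → IsSimple G ×
      (DefChromLe d (G ⊠K (d + 1)) (2 * d ^ 3 + 2 * d ^ 2 + d + 3) ×
       ChromGt G (2 * d ^ 3 + 2 * d ^ 2 + d + 3)))
theorem1 (suc (suc e)) (s≤s (s≤s z≤n)) =
  graph , graph-simple ,
  subst₂ (λ t k → DefChromLe (2 + e) (graph ⊠K t) k) (+-comm 1 (2 + e)) (sym k≡) product-DefChromLe ,
  subst (ChromGt graph) (sym k≡) (graph-ChromGt (n<1+n (s + (3 + e) * (3 + e) * 3)))
  where
  -- The construction works for any number s of clique colours; k exceeds 3(d+1)² by this s.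
  s : ℕ
  s = 2 * e ^ 3 + 11 * e ^ 2 + 15 * e + 2

  open DefectiveColouring s e
  open CliqueJoinC₅ (suc s) (3 + e)
  open +-*-Solver

  k≡ : 2 * (2 + e) ^ 3 + 2 * (2 + e) ^ 2 + (2 + e) + 3 ≡ s + (3 + e) * (3 + e) * 3
  k≡ = solve 1 (λ e → con 2 :* (con 2 :+ e) :^ 3 :+ con 2 :* (con 2 :+ e) :^ 2 :+ (con 2 :+ e) :+ con 3 :=
                 (con 2 :* e :^ 3 :+ con 11 :* e :^ 2 :+ con 15 :* e :+ con 2) :+ (con 3 :+ e) :* (con 3 :+ e) :* con 3)
             refl e
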